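{- Let $f(x,y)=a_dx^d+a_{d-1}x^{d-1}y+\cdots+a_1xy^{d-1}+a_0y^d$ be a homogeneous polynomial of degree $d\geq1$ with rational coefficients. Assume that $a_0+a_1+\cdots+a_d>0$ or $a_0>0$ or $a_d>0$. Let $r\geq1$, let $A_1,\dots,A_r$ be fixed positive integers, let $b>0$ be a fixed integer, and assume $d\leq r$. Then the equation $$b\,n_1!A_1^{n_1}\cdots n_r!A_r^{n_r}=f(x,y)$$ has infinitely many integer solutions $(n_1,\dots,n_r,x,y)$ with all $n_i>0$. -}

module Defs where

open import Data.Nat as ℕ using (ℕ; suc; _!)
open import Data.Integer as ℤ using (ℤ)
open import Data.Rational as ℚ using (ℚ; _+_; _*_; 0ℚ)
open import Data.Fin using (Fin; toℕ)
open import Data.Vec using (Vec; lookup)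
open import Data.Vec.Functional using (foldr)
open import Data.List using (List)
open import Data.List.Membership.Propositional using (_∉_)
open import Data.Product using (_×_; Σ; ∃; _,_)

Σℚ : ∀ {n} → (Fin n → ℚ) → ℚ
Σℚ f = foldr _+_ 0ℚ f

Πℕ : ∀ {n} → (Fin n → ℕ) → ℕ
Πℕ g = foldr ℕ._*_ 1 g

form : (d : ℕ) → (Fin (suc d) → ℚ) → ℤ → ℤ → ℚ
form d a x y = Σℚ (λ i → a i * ((x ℤ.^ toℕ i ℤ.* y ℤ.^ (d ℕ.∸ toℕ i)) ℚ./ 1))

lhs : ∀ {r} → ℕ → Vec ℕ r → Vec ℕ r → ℕ
lhs b A n = b ℕ.* Πℕ (λ i → (lookup n i) ! ℕ.* (lookup A i ℕ.^ lookup n i))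

Tuple : ℕ → Set
Tuple r = Vec ℕ r × ℤ × ℤ

module Submission where

-- The form takes the value c·t^d at (t,t), (0,t) or (t,0), with c = Σ aᵢ, a₀ or a_d, so
-- for a positive such c = p/q it suffices to solve q·b·∏ nᵢ! Aᵢ^nᵢ = p·t^d.  Take
-- n = (u+1, u, …, u, 1, …, 1) with d−1 entries u (this is where d ≤ r is used): the
-- left side becomes D·(u+1)·(u!)^d·B^u for constants B and D, and choosing
-- u+1 = d·K with K = p·B·D^(d−1)·d^(d−1)·w^d makes it p·(D·d·w·u!·B^K)^d.  As w
-- grows, n₁ = u+1 grows, so no finite list contains all of these solutions.

open import Defs
open import Algebra.Bundles using (CommutativeMonoid; Ring)
open import Data.Fin using (Fin; zero; suc; toℕ; fromℕ; punchIn)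
open import Data.Fin.Properties using (punchInᵢ≢i; toℕ≤pred[n]; toℕ-fromℕ)
open import Data.Nat as ℕ using (ℕ; suc; _≤_; _<_; _+_; _*_; _^_; _∸_; _!; s≤s; z<s; s<s; NonZero)
open import Data.Nat.Properties as ℕP using ([m*n]*[o*p]≡[m*o]*[n*p])
open import Data.Nat.ListAction using (sum; product)
open import Data.Nat.ListAction.Properties using (product≢0)
open import Data.Nat.Tactic.RingSolver using (solve-∀)
open import Data.Integer as ℤ using (ℤ; +_; -[1+_]; 0ℤ)
import Data.Integer.Properties as ℤP
open import Data.Rational as ℚ using (ℚ; mkℚ; 0ℚ; ↥_; ↧ₙ_; toℚᵘ) renaming (_<_ to _<ℚ_; _/_ to _/ℚ_)
open import Data.Rational.Properties as ℚP using (+-*-ring; toℚᵘ-injective; toℚᵘ-fromℚᵘ; toℚᵘ-homo-*)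
open import Data.Rational.Unnormalised as ℚᵘ using (mkℚᵘ)
import Data.Rational.Unnormalised.Properties as ℚᵘP
open import Data.Vec using (Vec; []; _∷_; lookup; replicate; toList)
open import Data.Vec.Properties using (lookup-replicate)
import Data.Vec.Functional as Vector
import Data.Vec.Relation.Unary.All.Properties as Vecᴬ
open import Data.List using (List; _∷_; map; take; drop)
open import Data.List.Relation.Unary.All as List using ()
open import Data.List.Relation.Unary.All.Properties using (take⁺; drop⁺)
open import Data.List.Relation.Unary.Any using (here; there)
open import Data.List.Membership.Propositional using (_∈_; _∉_)
open import Data.Product using (Σ; ∃; ∃₂; _×_; _,_; proj₁)
open import Data.Sum using (_⊎_; inj₁; inj₂)
open import Function using (_∘_)
open import Relation.Binary.PropositionalEquality
  using (_≡_; _≢_; refl; sym; trans; cong; cong₂; subst; module ≡-Reasoning)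
open import Relation.Nullary using (contradiction)

module _ {c ℓ} (M : CommutativeMonoid c ℓ) where
  open CommutativeMonoid M renaming (ε to 0#)
  open import Algebra.Properties.CommutativeMonoid.Sum M
    using (sum-remove; sum-cong-≋; sum-replicate-zero) renaming (sum to ∑)
  open import Relation.Binary.Reasoning.Setoid setoid

  sum-supported-at : ∀ {n} (t : Vector.Vector Carrier (suc n)) i →
                     (∀ j → j ≢ i → t j ≈ 0#) → ∑ t ≈ t i
  sum-supported-at {n} t i t≈0 = begin
    ∑ t                             ≈⟨ sum-remove t ⟩
    t i ∙ ∑ (Vector.removeAt t i)   ≈⟨ ∙-congˡ (sum-cong-≋ (λ j → t≈0 (punchIn i j) (punchInᵢ≢i i j))) ⟩
    t i ∙ ∑ (Vector.replicate n 0#) ≈⟨ ∙-congˡ (sum-replicate-zero n) ⟩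
    t i ∙ 0#                        ≈⟨ identityʳ (t i) ⟩
    t i                             ∎

open import Algebra.Properties.Semiring.Sum (Ring.semiring +-*-ring) using (*-distribʳ-sum; sum-cong-≗)

Σℚ-supported-at : ∀ {n} (t : Fin (suc n) → ℚ) i → (∀ j → j ≢ i → t j ≡ 0ℚ) → Σℚ t ≡ t i
Σℚ-supported-at = sum-supported-at (Ring.+-commutativeMonoid +-*-ring)

≢fromℕ⇒toℕ< : ∀ {d} (i : Fin (suc d)) → i ≢ fromℕ d → toℕ i < d
≢fromℕ⇒toℕ< {ℕ.zero} zero    i≢d = contradiction refl i≢d
≢fromℕ⇒toℕ< {suc d}  zero    _   = z<s
≢fromℕ⇒toℕ< {suc d}  (suc i) i≢d = s<s (≢fromℕ⇒toℕ< i (i≢d ∘ cong suc))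

0^n≡0 : ∀ n → .{{NonZero n}} → 0ℤ ℤ.^ n ≡ 0ℤ
0^n≡0 (suc n) = refl

pos-^ : ∀ m n → + (m ^ n) ≡ (+ m) ℤ.^ n
pos-^ m ℕ.zero  = refl
pos-^ m (suc n) = trans (ℤP.pos-* m (m ^ n)) (cong (+ m ℤ.*_) (pos-^ m n))

form-diagonal : ∀ d a t → form d a t t ≡ Σℚ a ℚ.* ((t ℤ.^ d) /ℚ 1)
form-diagonal d a t = trans (sum-cong-≗ monomial) (sym (*-distribʳ-sum ((t ℤ.^ d) /ℚ 1) a))
  where
  open ≡-Reasoning
  monomial : ∀ i → a i ℚ.* ((t ℤ.^ toℕ i ℤ.* t ℤ.^ (d ∸ toℕ i)) /ℚ 1) ≡ a i ℚ.* ((t ℤ.^ d) /ℚ 1)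
  monomial i = cong (λ z → a i ℚ.* (z /ℚ 1)) (begin
    t ℤ.^ toℕ i ℤ.* t ℤ.^ (d ∸ toℕ i) ≡⟨ ℤP.^-distribˡ-+-* t (toℕ i) (d ∸ toℕ i) ⟨
    t ℤ.^ (toℕ i + (d ∸ toℕ i))       ≡⟨ cong (t ℤ.^_) (ℕP.m+[n∸m]≡n (toℕ≤pred[n] i)) ⟩
    t ℤ.^ d                           ∎)

form-on-y-axis : ∀ d a t → form d a 0ℤ t ≡ a zero ℚ.* ((t ℤ.^ d) /ℚ 1)
form-on-y-axis d a t =
  trans (Σℚ-supported-at _ zero vanish) (cong (λ z → a zero ℚ.* (z /ℚ 1)) (ℤP.*-identityˡ (t ℤ.^ d)))
  where
  vanish : ∀ i → i ≢ zero → a i ℚ.* ((0ℤ ℤ.^ toℕ i ℤ.* t ℤ.^ (d ∸ toℕ i)) /ℚ 1) ≡ 0ℚ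
  vanish zero    i≢0 = contradiction refl i≢0
  vanish (suc i) _   = ℚP.*-zeroʳ (a (suc i))

form-on-x-axis : ∀ d a t → form d a t 0ℤ ≡ a (fromℕ d) ℚ.* ((t ℤ.^ d) /ℚ 1)
form-on-x-axis d a t =
  trans (Σℚ-supported-at _ (fromℕ d) vanish) (cong (λ z → a (fromℕ d) ℚ.* (z /ℚ 1)) top-monomial)
  where
  open ≡-Reasoning
  top-monomial : t ℤ.^ toℕ (fromℕ d) ℤ.* 0ℤ ℤ.^ (d ∸ toℕ (fromℕ d)) ≡ t ℤ.^ d
  top-monomial = begin
    t ℤ.^ toℕ (fromℕ d) ℤ.* 0ℤ ℤ.^ (d ∸ toℕ (fromℕ d))
      ≡⟨ cong (λ k → t ℤ.^ k ℤ.* 0ℤ ℤ.^ (d ∸ k)) (toℕ-fromℕ d) ⟩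
    t ℤ.^ d ℤ.* 0ℤ ℤ.^ (d ∸ d)
      ≡⟨ cong (λ k → t ℤ.^ d ℤ.* 0ℤ ℤ.^ k) (ℕP.n∸n≡0 d) ⟩
    t ℤ.^ d ℤ.* ℤ.1ℤ
      ≡⟨ ℤP.*-identityʳ (t ℤ.^ d) ⟩
    t ℤ.^ d ∎
  vanish : ∀ i → i ≢ fromℕ d → a i ℚ.* ((t ℤ.^ toℕ i ℤ.* 0ℤ ℤ.^ (d ∸ toℕ i)) /ℚ 1) ≡ 0ℚ
  vanish i i≢d = begin
    a i ℚ.* ((t ℤ.^ toℕ i ℤ.* 0ℤ ℤ.^ (d ∸ toℕ i)) /ℚ 1)
      ≡⟨ cong (λ z → a i ℚ.* ((t ℤ.^ toℕ i ℤ.* z) /ℚ 1)) 0^d∸i≡0 ⟩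
    a i ℚ.* ((t ℤ.^ toℕ i ℤ.* 0ℤ) /ℚ 1)
      ≡⟨ cong (λ z → a i ℚ.* (z /ℚ 1)) (ℤP.*-zeroʳ (t ℤ.^ toℕ i)) ⟩
    a i ℚ.* 0ℚ
      ≡⟨ ℚP.*-zeroʳ (a i) ⟩
    0ℚ ∎
    where
    0^d∸i≡0 : 0ℤ ℤ.^ (d ∸ toℕ i) ≡ 0ℤ
    0^d∸i≡0 = 0^n≡0 (d ∸ toℕ i) {{ℕ.>-nonZero (ℕP.m<n⇒0<n∸m (≢fromℕ⇒toℕ< i i≢d))}}

RepresentsPowerMultiples : (d : ℕ) → (Fin (suc d) → ℚ) → ℚ → Set
RepresentsPowerMultiples d a c = ∀ t → ∃₂ λ x y → form d a x y ≡ c ℚ.* ((t ℤ.^ d) /ℚ 1)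

represents-positive-multiple : ∀ d a → 0ℚ <ℚ Σℚ a ⊎ 0ℚ <ℚ a zero ⊎ 0ℚ <ℚ a (fromℕ d) →
                               ∃ λ c → 0ℚ <ℚ c × RepresentsPowerMultiples d a c
represents-positive-multiple d a (inj₁ 0<Σa)        = Σℚ a , 0<Σa , λ t → t , t , form-diagonal d a t
represents-positive-multiple d a (inj₂ (inj₁ 0<a₀)) = a zero , 0<a₀ , λ t → 0ℤ , t , form-on-y-axis d a t
represents-positive-multiple d a (inj₂ (inj₂ 0<ad)) = a (fromℕ d) , 0<ad , λ t → t , 0ℤ , form-on-x-axis d a t

positive-numerator : ∀ {c} → 0ℚ <ℚ c → ∃ λ p → ↥ c ≡ + suc p
positive-numerator {mkℚ (+ suc p)   _ _} _           = p , refl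
positive-numerator {mkℚ (+ ℕ.zero)  _ _} (ℚ.*<* 0<0) = contradiction 0<0 (ℤP.<-irrefl refl)
positive-numerator {mkℚ -[1+ _ ]    _ _} (ℚ.*<* ())

/1≡*-/1 : ∀ c {p m n} → ↥ c ≡ + p → m * ↧ₙ c ≡ p * n → (+ m) /ℚ 1 ≡ c ℚ.* ((+ n) /ℚ 1)
/1≡*-/1 c@record{} {p} {m} {n} ↥c≡p m↧c≡pn = toℚᵘ-injective toℚᵘ-equation
  where
  cross : + m ℤ.* + (↧ₙ c * 1) ≡ (↥ c ℤ.* + n) ℤ.* + 1
  cross = begin
    + m ℤ.* + (↧ₙ c * 1)    ≡⟨ ℤP.pos-* m (↧ₙ c * 1) ⟨
    + (m * (↧ₙ c * 1))      ≡⟨ cong (λ z → + (m * z)) (ℕP.*-identityʳ (↧ₙ c)) ⟩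
    + (m * ↧ₙ c)            ≡⟨ cong +_ m↧c≡pn ⟩
    + (p * n)               ≡⟨ ℤP.pos-* p n ⟩
    + p ℤ.* + n             ≡⟨ cong (ℤ._* + n) ↥c≡p ⟨
    ↥ c ℤ.* + n             ≡⟨ ℤP.*-identityʳ (↥ c ℤ.* + n) ⟨
    (↥ c ℤ.* + n) ℤ.* + 1   ∎
    where open ≡-Reasoning
  toℚᵘ-equation : toℚᵘ ((+ m) /ℚ 1) ℚᵘ.≃ toℚᵘ (c ℚ.* ((+ n) /ℚ 1))
  toℚᵘ-equation = begin
    toℚᵘ ((+ m) /ℚ 1)                ≈⟨ toℚᵘ-fromℚᵘ (mkℚᵘ (+ m) 0) ⟩
    mkℚᵘ (+ m) 0                     ≈⟨ ℚᵘ.*≡* cross ⟩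
    toℚᵘ c ℚᵘ.* mkℚᵘ (+ n) 0         ≈⟨ ℚᵘP.*-congˡ {toℚᵘ c} (toℚᵘ-fromℚᵘ (mkℚᵘ (+ n) 0)) ⟨
    toℚᵘ c ℚᵘ.* toℚᵘ ((+ n) /ℚ 1)    ≈⟨ toℚᵘ-homo-* c ((+ n) /ℚ 1) ⟨
    toℚᵘ (c ℚ.* ((+ n) /ℚ 1))        ∎
    where open ℚᵘP.≃-Reasoning

^-distribʳ-* : ∀ m n o → (m * n) ^ o ≡ m ^ o * n ^ o
^-distribʳ-* m n ℕ.zero  = refl
^-distribʳ-* m n (suc o) =
  trans (cong (m * n *_) (^-distribʳ-* m n o)) ([m*n]*[o*p]≡[m*o]*[n*p] m n (m ^ o) (n ^ o))

padWithOnes : ℕ → ℕ → (m : ℕ) → Vec ℕ m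
padWithOnes u ℕ.zero  m        = replicate m 1
padWithOnes u (suc k) ℕ.zero   = []
padWithOnes u (suc k) (suc m)  = u ∷ padWithOnes u k m

padWithOnes-positive : ∀ {u} k m → 0 < u → ∀ i → 0 < lookup (padWithOnes u k m) i
padWithOnes-positive ℕ.zero  m       _   i       = subst (0 <_) (sym (lookup-replicate i 1)) z<s
padWithOnes-positive (suc k) (suc m) 0<u zero    = 0<u
padWithOnes-positive (suc k) (suc m) 0<u (suc i) = padWithOnes-positive k m 0<u i

factorialPowers : ∀ {m} → Vec ℕ m → Vec ℕ m → ℕ
factorialPowers A n = Πℕ (λ i → lookup n i ! * lookup A i ^ lookup n i)

factorialPowers-ones : ∀ {m} (A : Vec ℕ m) → factorialPowers A (replicate m 1) ≡ product (toList A)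
factorialPowers-ones []      = refl
factorialPowers-ones (a ∷ A) =
  cong₂ _*_ (trans (ℕP.+-identityʳ (a * 1)) (ℕP.*-identityʳ a)) (factorialPowers-ones A)

factorialPowers-padWithOnes : ∀ u {m} k (A : Vec ℕ m) → k ≤ m →
  factorialPowers A (padWithOnes u k m)
    ≡ (u !) ^ k * product (take k (toList A)) ^ u * product (drop k (toList A))
factorialPowers-padWithOnes u ℕ.zero A _ = begin
  factorialPowers A (replicate _ 1) ≡⟨ factorialPowers-ones A ⟩
  product (toList A)                ≡⟨ ℕP.+-identityʳ _ ⟨
  1 * product (toList A)            ≡⟨ cong (λ z → 1 * z * product (toList A)) (ℕP.^-zeroˡ u) ⟨
  1 * 1 ^ u * product (toList A)    ∎
  where open ≡-Reasoning
factorialPowers-padWithOnes u (suc k) (a ∷ A) (s≤s k≤m) = begin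
  (u ! * a ^ u) * factorialPowers A (padWithOnes u k _)
    ≡⟨ cong ((u ! * a ^ u) *_) (factorialPowers-padWithOnes u k A k≤m) ⟩
  (u ! * a ^ u) * ((u !) ^ k * P ^ u * S)
    ≡⟨ regroup (u !) (a ^ u) ((u !) ^ k) (P ^ u) S ⟩
  u ! * (u !) ^ k * (a ^ u * P ^ u) * S
    ≡⟨ cong (λ z → u ! * (u !) ^ k * z * S) (^-distribʳ-* a P u) ⟨
  u ! * (u !) ^ k * (a * P) ^ u * S ∎
  where
  open ≡-Reasoning
  P = product (take k (toList A))
  S = product (drop k (toList A))
  regroup : ∀ f x g y z → (f * x) * (g * y * z) ≡ f * g * (x * y) * z
  regroup = solve-∀

lhs-padWithOnes : ∀ b A₀ {m} (A : Vec ℕ m) q u k → k ≤ m →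
  lhs b (A₀ ∷ A) (suc u ∷ padWithOnes u k m) * q
    ≡ (b * A₀ * product (drop k (toList A)) * q) * suc u * (u !) ^ suc k
        * (A₀ * product (take k (toList A))) ^ u
lhs-padWithOnes b A₀ A q u k k≤m = begin
  b * ((suc u * u ! * (A₀ * A₀ ^ u)) * factorialPowers A (padWithOnes u k _)) * q
    ≡⟨ cong (λ z → b * ((suc u * u ! * (A₀ * A₀ ^ u)) * z) * q) (factorialPowers-padWithOnes u k A k≤m) ⟩
  b * ((suc u * u ! * (A₀ * A₀ ^ u)) * ((u !) ^ k * P ^ u * S)) * q
    ≡⟨ regroup b (suc u) (u !) A₀ (A₀ ^ u) ((u !) ^ k) (P ^ u) S q ⟩
  (b * A₀ * S * q) * suc u * (u ! * (u !) ^ k) * (A₀ ^ u * P ^ u)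
    ≡⟨ cong ((b * A₀ * S * q) * suc u * (u ! * (u !) ^ k) *_) (^-distribʳ-* A₀ P u) ⟨
  (b * A₀ * S * q) * suc u * (u ! * (u !) ^ k) * (A₀ * P) ^ u ∎
  where
  open ≡-Reasoning
  P = product (take k (toList A))
  S = product (drop k (toList A))
  regroup : ∀ b n f a x g y s q →
            b * ((n * f * (a * x)) * (g * y * s)) * q ≡ (b * a * s * q) * n * (f * g) * (x * y)
  regroup = solve-∀

scaled-power : ∀ p B D F k w u → let d = suc k; K = p * B * D ^ k * d ^ k * w ^ d in
  suc u ≡ d * K → D * suc u * F ^ d * B ^ u ≡ p * (D * d * w * F * B ^ K) ^ d
scaled-power p B D F k w u 1+u≡dK = begin
  D * suc u * F ^ d * B ^ u
    ≡⟨ cong (λ z → D * z * F ^ d * B ^ u) 1+u≡dK ⟩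
  D * (d * K) * F ^ d * B ^ u
    ≡⟨ regroup D d p B (D ^ k) (d ^ k) (w ^ d) (F ^ d) (B ^ u) ⟩
  p * (D ^ d * d ^ d * w ^ d * F ^ d * B ^ suc u)
    ≡⟨ cong (λ z → p * (D ^ d * d ^ d * w ^ d * F ^ d * B ^ z)) (trans 1+u≡dK (ℕP.*-comm d K)) ⟩
  p * (D ^ d * d ^ d * w ^ d * F ^ d * B ^ (K * d))
    ≡⟨ cong (λ z → p * (D ^ d * d ^ d * w ^ d * F ^ d * z)) (ℕP.^-*-assoc B K d) ⟨
  p * (D ^ d * d ^ d * w ^ d * F ^ d * (B ^ K) ^ d)
    ≡⟨ cong (p *_) distribute ⟨
  p * (D * d * w * F * B ^ K) ^ d ∎
  where
  open ≡-Reasoning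
  d = suc k
  K = p * B * D ^ k * d ^ k * w ^ d
  regroup : ∀ D d p B Dᵏ dᵏ wᵈ Fᵈ Bᵘ →
            D * (d * (p * B * Dᵏ * dᵏ * wᵈ)) * Fᵈ * Bᵘ ≡ p * ((D * Dᵏ) * (d * dᵏ) * wᵈ * Fᵈ * (B * Bᵘ))
  regroup = solve-∀
  distribute : (D * d * w * F * B ^ K) ^ d ≡ D ^ d * d ^ d * w ^ d * F ^ d * (B ^ K) ^ d
  distribute = begin
    (D * d * w * F * B ^ K) ^ d                 ≡⟨ ^-distribʳ-* (D * d * w * F) (B ^ K) d ⟩
    (D * d * w * F) ^ d * (B ^ K) ^ d           ≡⟨ cong (_* (B ^ K) ^ d) (^-distribʳ-* (D * d * w) F d) ⟩
    (D * d * w) ^ d * F ^ d * (B ^ K) ^ d       ≡⟨ cong (λ z → z * F ^ d * (B ^ K) ^ d) (^-distribʳ-* (D * d) w d) ⟩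
    (D * d) ^ d * w ^ d * F ^ d * (B ^ K) ^ d   ≡⟨ cong (λ z → z * w ^ d * F ^ d * (B ^ K) ^ d) (^-distribʳ-* D d d) ⟩
    D ^ d * d ^ d * w ^ d * F ^ d * (B ^ K) ^ d ∎

w≤d*[C*wᵈ] : ∀ k C w → .{{NonZero C}} → .{{NonZero w}} → w ≤ suc k * (C * w ^ suc k)
w≤d*[C*wᵈ] k C w = begin
  w                      ≤⟨ ℕP.m≤m*n w (w ^ k) {{ℕP.m^n≢0 w k}} ⟩
  w ^ suc k              ≤⟨ ℕP.m≤n*m (w ^ suc k) C ⟩
  C * w ^ suc k          ≤⟨ ℕP.m≤n*m (C * w ^ suc k) (suc k) ⟩
  suc k * (C * w ^ suc k) ∎
  where open ℕP.≤-Reasoning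

pred-above : ∀ {s m} → suc s < m → ∃ λ u → suc u ≡ m × s < u
pred-above {m = suc u} (s≤s s<u) = u , refl , s<u

unbounded-power-solutions : ∀ {m k} → k ≤ m → ∀ b A₀ (A : Vec ℕ m) p q →
  .{{NonZero b}} → .{{NonZero A₀}} → .{{NonZero p}} → .{{NonZero q}} → List.All NonZero (toList A) →
  ∀ s → ∃₂ λ (n : Vec ℕ (suc m)) t →
    (∀ i → 0 < lookup n i) × lhs b (A₀ ∷ A) n * q ≡ p * t ^ suc k × s < lookup n zero
unbounded-power-solutions {m} {k} k≤m b A₀ A p q A≢0 s =
  let u , 1+u≡dK , s<u = pred-above (w≤d*[C*wᵈ] k C w)
  in suc u ∷ padWithOnes u k m , D * d * w * u ! * B ^ K
     , (λ { zero → z<s ; (suc i) → padWithOnes-positive k m (ℕP.≤-trans z<s s<u) i })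
     , trans (lhs-padWithOnes b A₀ A q u k k≤m) (scaled-power p B D (u !) k w u 1+u≡dK)
     , ℕP.m<n⇒m<1+n s<u
  where
  d = suc k
  w = suc (suc s)
  P = product (take k (toList A))
  S = product (drop k (toList A))
  B = A₀ * P
  D = b * A₀ * S * q
  C = p * B * D ^ k * d ^ k
  K = C * w ^ d
  instance
    P≢0 : NonZero P
    P≢0 = product≢0 (take⁺ k A≢0)
    S≢0 : NonZero S
    S≢0 = product≢0 (drop⁺ k A≢0)
    B≢0 : NonZero B
    B≢0 = ℕP.m*n≢0 A₀ P
    bA₀≢0 : NonZero (b * A₀)
    bA₀≢0 = ℕP.m*n≢0 b A₀
    bA₀S≢0 : NonZero (b * A₀ * S)
    bA₀S≢0 = ℕP.m*n≢0 (b * A₀) S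
    D≢0 : NonZero D
    D≢0 = ℕP.m*n≢0 (b * A₀ * S) q
    pB≢0 : NonZero (p * B)
    pB≢0 = ℕP.m*n≢0 p B
    Dᵏ≢0 : NonZero (D ^ k)
    Dᵏ≢0 = ℕP.m^n≢0 D k
    pBDᵏ≢0 : NonZero (p * B * D ^ k)
    pBDᵏ≢0 = ℕP.m*n≢0 (p * B) (D ^ k)
    dᵏ≢0 : NonZero (d ^ k)
    dᵏ≢0 = ℕP.m^n≢0 d k
    C≢0 : NonZero C
    C≢0 = ℕP.m*n≢0 (p * B * D ^ k) (d ^ k)

∈⇒≤sum-map : ∀ {X : Set} (g : X → ℕ) {x xs} → x ∈ xs → g x ≤ sum (map g xs)
∈⇒≤sum-map g (here refl)                = ℕP.m≤m+n _ _
∈⇒≤sum-map g {xs = y ∷ _} (there x∈xs) = ℕP.≤-trans (∈⇒≤sum-map g x∈xs) (ℕP.m≤n+m _ (g y))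

corollary1p9 : (d : ℕ) → 1 ≤ d → (a : Fin (suc d) → ℚ)
    → (0ℚ <ℚ Σℚ a ⊎ 0ℚ <ℚ a zero ⊎ 0ℚ <ℚ a (fromℕ d))
    → (r : ℕ) → 1 ≤ r → (A : Vec ℕ r) → (∀ i → 0 < lookup A i)
    → (b : ℕ) → 0 < b → d ≤ r
    → (L : List (Tuple r))
    → Σ (Vec ℕ r) λ n → Σ ℤ λ x → Σ ℤ λ y →
        (∀ i → 0 < lookup n i)
        × ((+ lhs b A n) /ℚ 1 ≡ form d a x y)
        × ((n , x , y) ∉ L)
corollary1p9 d@(suc k) _ a positivity (suc m) _ (A₀ ∷ A) 0<A b 0<b (s≤s k≤m) L =
  let c , 0<c , c-represented = represents-positive-multiple d a positivity
      p , ↥c≡1+p = positive-numerator 0<c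
      n , t , 0<n , lhs*q≡p*tᵈ , bound<n₀ =
        unbounded-power-solutions k≤m b A₀ A (suc p) (↧ₙ c) {{ℕ.>-nonZero 0<b}} {{ℕ.>-nonZero (0<A zero)}}
                                  A≢0 (sum (map firstExponent L))
      x , y , fxy≡ctᵈ = c-represented (+ t)
  in n , x , y , 0<n
     , trans (/1≡*-/1 c {m = lhs b (A₀ ∷ A) n} ↥c≡1+p lhs*q≡p*tᵈ)
             (trans (cong (λ z → c ℚ.* (z /ℚ 1)) (pos-^ t d)) (sym fxy≡ctᵈ))
     , λ τ∈L → ℕP.<⇒≱ bound<n₀ (∈⇒≤sum-map firstExponent τ∈L)
  where
  firstExponent : Tuple (suc m) → ℕ
  firstExponent τ = lookup (proj₁ τ) zero
  A≢0 : List.All NonZero (toList A)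
  A≢0 = Vecᴬ.toList⁺ (Vecᴬ.lookup⁻ (ℕ.>-nonZero ∘ 0<A ∘ suc))
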